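{- Let $\lambda$ be a nonzero real number and $y$ a nonzero real number. For all integers $n,p\ge0$, $$ \sum_{k=0}^{n}(-1)^{k}\binom{x}{k}(z+yk)_{p,\lambda}=\sum_{r=0}^{p}\binom{p}{r}(z)_{p-r,\lambda}\,y^{r}\sum_{j=0}^{r}(-1)^{j}\binom{n-x}{n-j}\binom{x}{j}j!{r \brace j}_{\lambda/y}. $$
   Context: For a real parameter $\mu$ the degenerate falling factorials are $(x)_{0,\mu}=1$ and $(x)_{n,\mu}=x(x-\mu)\cdots(x-(n-1)\mu)$ for $n\ge1$; $(x)_n=(x)_{n,1}$ is the usual falling factorial. Binomial coefficients are $\binom{w}{m}=(w)_m/m!$ for integers $m\ge0$ and $\binom{w}{m}=0$ for integers $m<0$. The degenerate Stirling numbers of the second kind ${n \brace k}_{\mu}$ are defined by $(x)_{n,\mu}=\sum_{k=0}^{n}{n \brace k}_{\mu}(x)_k$. -}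

module Defs where

open import Level using (_⊔_) renaming (suc to lsuc)
open import Data.Nat using (ℕ; zero; suc)
open import Data.Integer using (ℤ; +_; -[1+_])
open import Relation.Nullary using (¬_)
open import Algebra.Bundles using (CommutativeRing)

ι : ∀ {c ℓ} (R : CommutativeRing c ℓ) → ℕ → CommutativeRing.Carrier R
ι R zero    = CommutativeRing.0# R
ι R (suc n) = CommutativeRing._+_ R (CommutativeRing.1# R) (ι R n)

-- A field of characteristic zero: a commutative ring with an inverse
-- operation that is a genuine inverse on nonzero elements (its value at 0#
-- is irrelevant), and with n·1 ≠ 0 for all n ≥ 1.
record CharZeroField c ℓ : Set (lsuc (c ⊔ ℓ)) where
  field
    commutativeRing : CommutativeRing c ℓ
  open CommutativeRing commutativeRing public
  infix 8 _⁻¹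
  field
    _⁻¹       : Carrier → Carrier
    ⁻¹-inverse : ∀ a → ¬ (a ≈ 0#) → (a * (a ⁻¹)) ≈ 1#

    charZero   : ∀ n → ¬ (ι commutativeRing (suc n) ≈ 0#)

  ι′ : ℕ → Carrier
  ι′ = ι commutativeRing

module FieldOps {c ℓ} (F : CharZeroField c ℓ) where
  open CharZeroField F
  private ιF = ι commutativeRing

  pow : Carrier → ℕ → Carrier
  pow a zero    = 1#
  pow a (suc n) = pow a n * a

  sgn : ℕ → Carrier
  sgn k = pow (- 1#) k

  sumTo : ℕ → (ℕ → Carrier) → Carrier
  sumTo zero    f = f 0
  sumTo (suc n) f = sumTo n f + f (suc n)

  fact : ℕ → Carrier
  fact zero    = 1#
  fact (suc n) = fact n * ιF (suc n)

  dff : Carrier → ℕ → Carrier → Carrier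
  dff x zero    μ = 1#
  dff x (suc n) μ = dff x n μ * (x - ιF n * μ)

  ff : Carrier → ℕ → Carrier
  ff x n = dff x n 1#

  binom : Carrier → ℕ → Carrier
  binom w m = ff w m * (fact m) ⁻¹

  binomℤ : Carrier → ℤ → Carrier
  binomℤ w (+ m)    = binom w m
  binomℤ w -[1+ m ] = 0#

  _/_ : Carrier → Carrier → Carrier
  a / b = a * b ⁻¹

-- Expand (z + y k)_{p,λ} by the binomial theorem for degenerate falling
-- factorials and rescale with y^r (k)_{r,λ/y} = (y k)_{r,λ}.  Writing
-- (k)_{r,λ/y} in falling factorials (k)_j via the Stirling numbers reduces the
-- theorem to the alternating sum
--   Σ_{k≤n} (-1)^k C(x,k) (k)_j = (-1)^j C(n-x, n-j) C(x,j) j!,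
-- which follows by induction on n from Pascal's rule: by upper negation and
-- trinomial revision the new summand (-1)^(n+1) C(x,n+1) (n+1)_j equals
-- (-1)^j C(n-x, n+1-j) C(x,j) j!.
module Submission where

open import Defs
open import Data.Nat using (ℕ; zero; suc)
import Data.Nat as ℕ
import Data.Nat.Properties as ℕ
open import Data.Integer as ℤ using (ℤ; +_; -[1+_]; _⊖_; sign; ∣_∣; _◃_) renaming (_-_ to _-ℤ_)
import Data.Integer.Properties as ℤ
open import Data.Sign as Sign using (Sign)
open import Data.Sum using (inj₁; inj₂)
open import Data.Maybe using (Maybe; just; nothing)
open import Relation.Nullary using (yes; no; ¬_)
open import Relation.Binary.PropositionalEquality as ≡ using (_≡_)
open import Algebra.Bundles using (CommutativeRing)
open import Algebra.Solver.Ring.AlmostCommutativeRing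
  using (fromCommutativeRing; _-Raw-AlmostCommutative⟶_)
import Algebra.Solver.Ring
import Algebra.Properties.Ring
import Algebra.Properties.AbelianGroup
import Algebra.Properties.Semiring.Mult.TCOptimised
import Algebra.Properties.CommutativeSemigroup

module IntegerCoefficientSolver {c ℓ} (R : CommutativeRing c ℓ) where
  open CommutativeRing R
  open Algebra.Properties.Ring ring using (-0#≈0#; -1*x≈-x; -‿distribʳ-*)
  open Algebra.Properties.AbelianGroup +-abelianGroup
    using (//-rightDividesʳ; ⁻¹-anti-homo‿-; ⁻¹-∙-comm; ⁻¹-involutive)
  open Algebra.Properties.Semiring.Mult.TCOptimised semiring
    using (_×_; ×-homo-+; ×1-homo-*)
  open Algebra.Properties.CommutativeSemigroup *-commutativeSemigroup
    using () renaming (interchange to *-interchange)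
  open import Relation.Binary.Reasoning.Setoid setoid

  -- The optimised n × 1# makes ⟦ + 0 ⟧ and ⟦ + 1 ⟧ reduce to 0# and 1#, so the
  -- solver's con (+ 0) and con (+ 1) stand for 0# and 1# definitionally.
  ⟦_⟧ : ℤ → Carrier
  ⟦ + n ⟧      = n × 1#
  ⟦ -[1+ n ] ⟧ = - (suc n × 1#)

  private
    ∸-homo : ∀ {m n} → n ℕ.≤ m → (m ℕ.∸ n) × 1# ≈ m × 1# - n × 1#
    ∸-homo {m} {n} n≤m = begin
      (m ℕ.∸ n) × 1#                      ≈⟨ //-rightDividesʳ (n × 1#) _ ⟨
      (m ℕ.∸ n) × 1# + n × 1# - n × 1#    ≈⟨ +-congʳ (×-homo-+ 1# (m ℕ.∸ n) n) ⟨
      (m ℕ.∸ n ℕ.+ n) × 1# - n × 1#       ≡⟨ ≡.cong (λ k → k × 1# - n × 1#) (ℕ.m∸n+n≡m n≤m) ⟩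
      m × 1# - n × 1#                     ∎

    -‿homo : ∀ i → ⟦ ℤ.- i ⟧ ≈ - ⟦ i ⟧
    -‿homo (+ zero)  = sym -0#≈0#
    -‿homo (+ suc n) = refl
    -‿homo -[1+ n ]  = sym (⁻¹-involutive _)

    ⊖-homo : ∀ m n → ⟦ m ⊖ n ⟧ ≈ m × 1# - n × 1#
    ⊖-homo m n with ℕ.≤-<-connex n m
    ... | inj₁ n≤m rewrite ℤ.⊖-≥ n≤m = ∸-homo n≤m
    ... | inj₂ m<n rewrite ℤ.⊖-< m<n = begin
      ⟦ ℤ.- (+ (n ℕ.∸ m)) ⟧     ≈⟨ -‿homo (+ (n ℕ.∸ m)) ⟩
      - ((n ℕ.∸ m) × 1#)        ≈⟨ -‿cong (∸-homo (ℕ.<⇒≤ m<n)) ⟩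
      - (n × 1# - m × 1#)       ≈⟨ ⁻¹-anti-homo‿- _ _ ⟩
      m × 1# - n × 1#           ∎

    +-homo : ∀ i j → ⟦ i ℤ.+ j ⟧ ≈ ⟦ i ⟧ + ⟦ j ⟧
    +-homo (+ m)    (+ n)    = ×-homo-+ 1# m n
    +-homo (+ m)    -[1+ n ] = ⊖-homo m (suc n)
    +-homo -[1+ m ] (+ n)    = trans (⊖-homo n (suc m)) (+-comm _ _)
    +-homo -[1+ m ] -[1+ n ] = begin
      - (suc (suc m ℕ.+ n) × 1#)           ≡⟨ ≡.cong (λ k → - (suc k × 1#)) (ℕ.+-suc m n) ⟨
      - ((suc m ℕ.+ suc n) × 1#)           ≈⟨ -‿cong (×-homo-+ 1# (suc m) (suc n)) ⟩
      - (suc m × 1# + suc n × 1#)          ≈⟨ ⁻¹-∙-comm _ _ ⟨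
      - (suc m × 1#) + - (suc n × 1#)      ∎

    ⟦sign⟧ : Sign → Carrier
    ⟦sign⟧ Sign.+ = 1#
    ⟦sign⟧ Sign.- = - 1#

    sign-homo : ∀ s t → ⟦sign⟧ (s Sign.* t) ≈ ⟦sign⟧ s * ⟦sign⟧ t
    sign-homo Sign.+ t      = sym (*-identityˡ _)
    sign-homo Sign.- Sign.+ = sym (*-identityʳ _)
    sign-homo Sign.- Sign.- = begin
      1#              ≈⟨ ⁻¹-involutive 1# ⟨
      - - 1#          ≈⟨ -‿cong (-1*x≈-x 1#) ⟨
      - (- 1# * 1#)   ≈⟨ -‿distribʳ-* _ _ ⟩
      - 1# * - 1#     ∎

    ◃-homo : ∀ s n → ⟦ s ◃ n ⟧ ≈ ⟦sign⟧ s * n × 1#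
    ◃-homo s      zero    = sym (zeroʳ _)
    ◃-homo Sign.+ (suc n) = sym (*-identityˡ _)
    ◃-homo Sign.- (suc n) = sym (-1*x≈-x _)

    sign-abs : ∀ i → ⟦ i ⟧ ≈ ⟦sign⟧ (sign i) * ∣ i ∣ × 1#
    sign-abs i = trans (reflexive (≡.cong ⟦_⟧ (≡.sym (ℤ.◃-inverse i)))) (◃-homo (sign i) ∣ i ∣)

    *-homo : ∀ i j → ⟦ i ℤ.* j ⟧ ≈ ⟦ i ⟧ * ⟦ j ⟧
    *-homo i j = begin
      ⟦ sign i Sign.* sign j ◃ ∣ i ∣ ℕ.* ∣ j ∣ ⟧                  ≈⟨ ◃-homo (sign i Sign.* sign j) (∣ i ∣ ℕ.* ∣ j ∣) ⟩
      ⟦sign⟧ (sign i Sign.* sign j) * (∣ i ∣ ℕ.* ∣ j ∣) × 1#       ≈⟨ *-cong (sign-homo (sign i) (sign j)) (×1-homo-* ∣ i ∣ ∣ j ∣) ⟩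
      (si * sj) * (ai * aj)                                        ≈⟨ *-interchange si sj ai aj ⟩
      (si * ai) * (sj * aj)                                        ≈⟨ *-cong (sign-abs i) (sign-abs j) ⟨
      ⟦ i ⟧ * ⟦ j ⟧                                                ∎
      where
      si = ⟦sign⟧ (sign i); sj = ⟦sign⟧ (sign j)
      ai = ∣ i ∣ × 1#;      aj = ∣ j ∣ × 1#

  homomorphism : ℤ.+-*-rawRing -Raw-AlmostCommutative⟶ fromCommutativeRing R
  homomorphism = record
    { ⟦_⟧ = ⟦_⟧ ; +-homo = +-homo ; *-homo = *-homo ; -‿homo = -‿homo
    ; 0-homo = refl ; 1-homo = refl }

  ⟦⟧-equal? : ∀ i j → Maybe (⟦ i ⟧ ≈ ⟦ j ⟧)
  ⟦⟧-equal? i j with i ℤ.≟ j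
  ... | yes ≡.refl = just refl
  ... | no _       = nothing

  open Algebra.Solver.Ring ℤ.+-*-rawRing (fromCommutativeRing R) homomorphism ⟦⟧-equal? public
    using (solve; _:+_; _:*_; _:-_; :-_; con; _:=_)

module DegenerateFactorialIdentities {c ℓ} (F : CharZeroField c ℓ) where
  open CharZeroField F
  open FieldOps F
  open IntegerCoefficientSolver commutativeRing
  open Algebra.Properties.CommutativeSemigroup *-commutativeSemigroup
    using (xy∙z≈x∙zy; xy∙z≈y∙xz)
  open import Relation.Binary.Reasoning.Setoid setoid

  ι-+ : ∀ m n → ι′ (m ℕ.+ n) ≈ ι′ m + ι′ n
  ι-+ zero    n = sym (+-identityˡ _)
  ι-+ (suc m) n = trans (+-congˡ (ι-+ m n)) (sym (+-assoc _ _ _))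

  ι-∸ : ∀ {m n} → n ℕ.≤ m → ι′ m ≈ ι′ (m ℕ.∸ n) + ι′ n
  ι-∸ {m} {n} n≤m = trans (reflexive (≡.cong ι′ (≡.sym (ℕ.m∸n+n≡m n≤m)))) (ι-+ (m ℕ.∸ n) n)

  sumTo-cong≤ : ∀ n {f g : ℕ → Carrier} → (∀ k → k ℕ.≤ n → f k ≈ g k) → sumTo n f ≈ sumTo n g
  sumTo-cong≤ zero    f≈g = f≈g 0 ℕ.z≤n
  sumTo-cong≤ (suc n) f≈g =
    +-cong (sumTo-cong≤ n (λ k k≤n → f≈g k (ℕ.m≤n⇒m≤1+n k≤n))) (f≈g (suc n) ℕ.≤-refl)

  sumTo-cong : ∀ n {f g : ℕ → Carrier} → (∀ k → f k ≈ g k) → sumTo n f ≈ sumTo n g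
  sumTo-cong n f≈g = sumTo-cong≤ n (λ k _ → f≈g k)

  sumTo-+ : ∀ n (f g : ℕ → Carrier) → sumTo n (λ k → f k + g k) ≈ sumTo n f + sumTo n g
  sumTo-+ zero    f g = refl
  sumTo-+ (suc n) f g = trans (+-congʳ (sumTo-+ n f g)) (+-interchange _ _ _ _)
    where open Algebra.Properties.CommutativeSemigroup +-commutativeSemigroup
            using () renaming (interchange to +-interchange)

  *-distribˡ-sumTo : ∀ n a (f : ℕ → Carrier) → a * sumTo n f ≈ sumTo n (λ k → a * f k)
  *-distribˡ-sumTo zero    a f = refl
  *-distribˡ-sumTo (suc n) a f = trans (distribˡ _ _ _) (+-congʳ (*-distribˡ-sumTo n a f))

  *-distribʳ-sumTo : ∀ n a (f : ℕ → Carrier) → sumTo n f * a ≈ sumTo n (λ k → f k * a)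
  *-distribʳ-sumTo n a f =
    trans (*-comm _ _) (trans (*-distribˡ-sumTo n a f) (sumTo-cong n (λ k → *-comm _ _)))

  sumTo-suc : ∀ n (f : ℕ → Carrier) → sumTo (suc n) f ≈ f 0 + sumTo n (λ k → f (suc k))
  sumTo-suc zero    f = refl
  sumTo-suc (suc n) f = trans (+-congʳ (sumTo-suc n f)) (+-assoc _ _ _)

  sumTo-comm : ∀ m n (f : ℕ → ℕ → Carrier) →
               sumTo m (λ i → sumTo n (f i)) ≈ sumTo n (λ j → sumTo m (λ i → f i j))
  sumTo-comm zero    n f = refl
  sumTo-comm (suc m) n f = trans (+-congʳ (sumTo-comm m n f)) (sym (sumTo-+ n _ _))

  1≉0 : ¬ (1# ≈ 0#)
  1≉0 1≈0 = charZero 0 (trans (+-identityʳ 1#) 1≈0)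

  *-inverse-cancelʳ : ∀ {c} a → ¬ (c ≈ 0#) → a * c * c ⁻¹ ≈ a
  *-inverse-cancelʳ {c} a c≉0 =
    trans (*-assoc _ _ _) (trans (*-congˡ (⁻¹-inverse c c≉0)) (*-identityʳ a))

  inverse-*-cancelʳ : ∀ {c} a → ¬ (c ≈ 0#) → a * c ⁻¹ * c ≈ a
  inverse-*-cancelʳ {c} a c≉0 =
    trans (xy∙z≈x∙zy a (c ⁻¹) c) (trans (*-congˡ (⁻¹-inverse c c≉0)) (*-identityʳ a))

  *-cancelʳ-nonZero : ∀ {a b c} → ¬ (c ≈ 0#) → a * c ≈ b * c → a ≈ b
  *-cancelʳ-nonZero {a} {b} {c} c≉0 ac≈bc = begin
    a               ≈⟨ *-inverse-cancelʳ a c≉0 ⟨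
    a * c * c ⁻¹    ≈⟨ *-congʳ ac≈bc ⟩
    b * c * c ⁻¹    ≈⟨ *-inverse-cancelʳ b c≉0 ⟩
    b               ∎

  *-nonZero : ∀ {a b} → ¬ (a ≈ 0#) → ¬ (b ≈ 0#) → ¬ (a * b ≈ 0#)
  *-nonZero {a} {b} a≉0 b≉0 ab≈0 = b≉0 (begin
    b                 ≈⟨ inverse-*-cancelʳ b a≉0 ⟨
    b * a ⁻¹ * a      ≈⟨ xy∙z≈y∙xz b (a ⁻¹) a ⟩
    a ⁻¹ * (b * a)    ≈⟨ *-congˡ (trans (*-comm b a) ab≈0) ⟩
    a ⁻¹ * 0#         ≈⟨ zeroʳ _ ⟩
    0#                ∎)

  fact-nonZero : ∀ k → ¬ (fact k ≈ 0#)
  fact-nonZero zero    = 1≉0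
  fact-nonZero (suc k) = *-nonZero (fact-nonZero k) (charZero k)

  binom-*-fact : ∀ w m → binom w m * fact m ≈ ff w m
  binom-*-fact w m = inverse-*-cancelʳ (ff w m) (fact-nonZero m)

  binom-zero : ∀ w → binom w 0 ≈ 1#
  binom-zero w = trans (sym (*-identityʳ _)) (binom-*-fact w 0)

  dff-cong : ∀ {a b} n μ → a ≈ b → dff a n μ ≈ dff b n μ
  dff-cong zero    μ a≈b = refl
  dff-cong (suc n) μ a≈b = *-cong (dff-cong n μ a≈b) (+-congʳ a≈b)

  binom-cong : ∀ {a b} m → a ≈ b → binom a m ≈ binom b m
  binom-cong m a≈b = *-congʳ (dff-cong m 1# a≈b)

  binomℤ-cong : ∀ {a b} d → a ≈ b → binomℤ a d ≈ binomℤ b d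
  binomℤ-cong (+ m)    a≈b = binom-cong m a≈b
  binomℤ-cong -[1+ m ] a≈b = refl

  pow-+ : ∀ a m n → pow a (m ℕ.+ n) ≈ pow a m * pow a n
  pow-+ a m zero    = trans (reflexive (≡.cong (pow a) (ℕ.+-identityʳ m))) (sym (*-identityʳ _))
  pow-+ a m (suc n) = begin
    pow a (m ℕ.+ suc n)        ≡⟨ ≡.cong (pow a) (ℕ.+-suc m n) ⟩
    pow a (m ℕ.+ n) * a        ≈⟨ *-congʳ (pow-+ a m n) ⟩
    pow a m * pow a n * a      ≈⟨ *-assoc _ _ _ ⟩
    pow a m * (pow a n * a)    ∎

  dff-+ : ∀ a j m μ → dff a (j ℕ.+ m) μ ≈ dff a j μ * dff (a - ι′ j * μ) m μ
  dff-+ a j zero μ =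
    trans (reflexive (≡.cong (λ n → dff a n μ) (ℕ.+-identityʳ j))) (sym (*-identityʳ _))
  dff-+ a j (suc m) μ = begin
    dff a (j ℕ.+ suc m) μ                               ≡⟨ ≡.cong (λ n → dff a n μ) (ℕ.+-suc j m) ⟩
    dff a (j ℕ.+ m) μ * (a - ι′ (j ℕ.+ m) * μ)          ≈⟨ *-cong (dff-+ a j m μ) (+-congˡ (-‿cong (*-congʳ (ι-+ j m)))) ⟩
    D * E * (a - (ι′ j + ι′ m) * μ)                     ≈⟨ regroup D E a (ι′ j) (ι′ m) μ ⟩
    D * (E * ((a - ι′ j * μ) - ι′ m * μ))               ∎
    where
    D = dff a j μ
    E = dff (a - ι′ j * μ) m μ
    regroup : ∀ D E a J M μ → D * E * (a - (J + M) * μ) ≈ D * (E * ((a - J * μ) - M * μ))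
    regroup = solve 6 (λ D E a J M μ →
      D :* E :* (a :- (J :+ M) :* μ) := D :* (E :* ((a :- J :* μ) :- M :* μ))) refl

  dff-suc : ∀ a m μ → dff a (suc m) μ ≈ a * dff (a - μ) m μ
  dff-suc a m μ = trans (dff-+ a 1 m μ) (*-cong (lead a μ) (dff-cong m μ (shift a μ)))
    where
    lead : ∀ a μ → 1# * (a - 0# * μ) ≈ a
    lead = solve 2 (λ a μ → con (+ 1) :* (a :- con (+ 0) :* μ) := a) refl
    shift : ∀ a μ → a - (1# + 0#) * μ ≈ a - μ
    shift = solve 2 (λ a μ → a :- (con (+ 1) :+ con (+ 0)) :* μ := a :- μ) refl

  ff-+ : ∀ a j m → ff a (j ℕ.+ m) ≈ ff a j * ff (a - ι′ j) m
  ff-+ a j m = trans (dff-+ a j m 1#) (*-congˡ (dff-cong m 1# (+-congˡ (-‿cong (*-identityʳ _)))))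

  ff-ι-vanishes : ∀ {N j} → N ℕ.< j → ff (ι′ N) j ≈ 0#
  ff-ι-vanishes {N} {suc j} (ℕ.s≤s N≤j) with ℕ.m≤n⇒m<n∨m≡n N≤j
  ... | inj₁ N<j    = trans (*-congʳ (ff-ι-vanishes N<j)) (zeroˡ _)
  ... | inj₂ ≡.refl = trans (*-congˡ (self-cancel (ι′ N))) (zeroʳ _)
    where
    self-cancel : ∀ a → a - a * 1# ≈ 0#
    self-cancel = solve 1 (λ a → a :- a :* con (+ 1) := con (+ 0)) refl

  binom-ι-vanishes : ∀ {N m} → N ℕ.< m → binom (ι′ N) m ≈ 0#
  binom-ι-vanishes N<m = trans (*-congʳ (ff-ι-vanishes N<m)) (zeroˡ _)

  ff-ι-self : ∀ N → ff (ι′ N) N ≈ fact N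
  ff-ι-self zero    = refl
  ff-ι-self (suc N) = begin
    ff (ι′ (suc N)) (suc N)                 ≈⟨ dff-suc _ N 1# ⟩
    ι′ (suc N) * ff (1# + ι′ N - 1#) N      ≈⟨ *-congˡ (dff-cong N 1# (cancel-one (ι′ N))) ⟩
    ι′ (suc N) * ff (ι′ N) N                ≈⟨ *-congˡ (ff-ι-self N) ⟩
    ι′ (suc N) * fact N                     ≈⟨ *-comm _ _ ⟩
    fact N * ι′ (suc N)                     ∎
    where
    cancel-one : ∀ a → 1# + a - 1# ≈ a
    cancel-one = solve 1 (λ a → con (+ 1) :+ a :- con (+ 1) := a) refl

  ff-ι-*-fact : ∀ j m → ff (ι′ (j ℕ.+ m)) j * fact m ≈ fact (j ℕ.+ m)
  ff-ι-*-fact j m = begin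
    ff (ι′ N) j * fact m                    ≈⟨ *-congˡ (ff-ι-self m) ⟨
    ff (ι′ N) j * ff (ι′ m) m               ≈⟨ *-congˡ (dff-cong m 1# ι-m) ⟩
    ff (ι′ N) j * ff (ι′ N - ι′ j) m        ≈⟨ ff-+ (ι′ N) j m ⟨
    ff (ι′ N) N                             ≈⟨ ff-ι-self N ⟩
    fact N                                  ∎
    where
    N = j ℕ.+ m
    cancel : ∀ J M → M ≈ (J + M) - J
    cancel = solve 2 (λ J M → M := (J :+ M) :- J) refl
    ι-m : ι′ m ≈ ι′ N - ι′ j
    ι-m = trans (cancel (ι′ j) (ι′ m)) (+-congʳ (sym (ι-+ j m)))

  ff-reflect : ∀ {a b} m → a + b + 1# ≈ ι′ m → ff a m ≈ sgn m * ff b m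
  ff-reflect zero    _ = sym (*-identityˡ _)
  ff-reflect {a} {b} (suc m) a+b+1≈m+1 = begin
    ff a (suc m)                      ≈⟨ dff-suc a m 1# ⟩
    a * ff (a - 1#) m                 ≈⟨ *-cong a≈m-b (ff-reflect m a-1+b+1≈m) ⟩
    (ι′ m - b) * (sgn m * ff b m)     ≈⟨ regroup (ι′ m) b (sgn m) (ff b m) ⟩
    sgn (suc m) * ff b (suc m)        ∎
    where
    a≈m-b : a ≈ ι′ m - b
    a≈m-b = begin
      a                         ≈⟨ solve 2 (λ a b → a := a :+ b :+ con (+ 1) :- con (+ 1) :- b) refl a b ⟩
      a + b + 1# - 1# - b       ≈⟨ +-congʳ (+-congʳ a+b+1≈m+1) ⟩
      1# + ι′ m - 1# - b        ≈⟨ solve 2 (λ M b → con (+ 1) :+ M :- con (+ 1) :- b := M :- b) refl (ι′ m) b ⟩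
      ι′ m - b                  ∎
    a-1+b+1≈m : a - 1# + b + 1# ≈ ι′ m
    a-1+b+1≈m = begin
      a - 1# + b + 1#         ≈⟨ +-congʳ (+-congʳ (+-congʳ a≈m-b)) ⟩
      ι′ m - b - 1# + b + 1#  ≈⟨ solve 2 (λ M b → M :- b :- con (+ 1) :+ b :+ con (+ 1) := M) refl (ι′ m) b ⟩
      ι′ m                    ∎
    regroup : ∀ M b S B → (M - b) * (S * B) ≈ S * - 1# * (B * (b - M * 1#))
    regroup = solve 4 (λ M b S B →
      (M :- b) :* (S :* B) := S :* :- con (+ 1) :* (B :* (b :- M :* con (+ 1)))) refl

  binom-reflect : ∀ {a b} m → a + b + 1# ≈ ι′ m → binom a m ≈ sgn m * binom b m
  binom-reflect m a+b+1≈m = trans (*-congʳ (ff-reflect m a+b+1≈m)) (*-assoc _ _ _)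

  pascal : ∀ w m → binom (w + 1#) (suc m) ≈ binom w m + binom w (suc m)
  pascal w m = *-cancelʳ-nonZero (fact-nonZero (suc m)) (begin
    binom (w + 1#) (suc m) * fact (suc m)                          ≈⟨ binom-*-fact (w + 1#) (suc m) ⟩
    ff (w + 1#) (suc m)                                            ≈⟨ dff-suc (w + 1#) m 1# ⟩
    (w + 1#) * ff (w + 1# - 1#) m                                  ≈⟨ *-congˡ (dff-cong m 1# (cancel-one w)) ⟩
    (w + 1#) * ff w m                                              ≈⟨ split w (ff w m) (ι′ m) ⟩
    ff w m * (1# + ι′ m) + ff w (suc m)                            ≈⟨ +-congʳ (*-congʳ (binom-*-fact w m)) ⟨
    binom w m * fact m * (1# + ι′ m) + ff w (suc m)                ≈⟨ +-cong (sym (*-assoc _ _ _)) (binom-*-fact w (suc m)) ⟨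
    binom w m * fact (suc m) + binom w (suc m) * fact (suc m)      ≈⟨ distribʳ _ _ _ ⟨
    (binom w m + binom w (suc m)) * fact (suc m)                   ∎)
    where
    cancel-one : ∀ w → w + 1# - 1# ≈ w
    cancel-one = solve 1 (λ w → w :+ con (+ 1) :- con (+ 1) := w) refl
    split : ∀ w F M → (w + 1#) * F ≈ F * (1# + M) + F * (w - M * 1#)
    split = solve 3 (λ w F M →
      (w :+ con (+ 1)) :* F := F :* (con (+ 1) :+ M) :+ F :* (w :- M :* con (+ 1))) refl

  pascalℤ : ∀ w d → binomℤ (w + 1#) (ℤ.suc d) ≈ binomℤ w d + binomℤ w (ℤ.suc d)
  pascalℤ w (+ m)          = pascal w m
  pascalℤ w -[1+ zero ]    = sym (+-identityˡ _)
  pascalℤ w -[1+ suc m ]   = sym (+-identityˡ _)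

  binomℤ-negative : ∀ w {N j} → N ℕ.< j → binomℤ w ((+ N) ℤ.- (+ j)) ≈ 0#
  binomℤ-negative w {N} {j} N<j rewrite ℤ.m-n≡m⊖n N j | ℤ.⊖-< N<j
    with j ℕ.∸ N | ℕ.m<n⇒0<n∸m N<j
  ... | suc _ | _ = refl

  trinomial-revision : ∀ x j m → ff x j * binom (x - ι′ j) m ≈ binom x (j ℕ.+ m) * ff (ι′ (j ℕ.+ m)) j
  trinomial-revision x j m = *-cancelʳ-nonZero (fact-nonZero m) (begin
    ff x j * binom (x - ι′ j) m * fact m        ≈⟨ *-assoc _ _ _ ⟩
    ff x j * (binom (x - ι′ j) m * fact m)      ≈⟨ *-congˡ (binom-*-fact (x - ι′ j) m) ⟩
    ff x j * ff (x - ι′ j) m                    ≈⟨ ff-+ x j m ⟨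
    ff x N                                      ≈⟨ binom-*-fact x N ⟨
    binom x N * fact N                          ≈⟨ *-congˡ (ff-ι-*-fact j m) ⟨
    binom x N * (ff (ι′ N) j * fact m)          ≈⟨ *-assoc _ _ _ ⟨
    binom x N * ff (ι′ N) j * fact m            ∎)
    where N = j ℕ.+ m

  binomial-step : ∀ p (A B : ℕ → Carrier) →
    sumTo p (λ r → binom (ι′ p) r * A (suc (p ℕ.∸ r)) * B r + binom (ι′ p) r * A (p ℕ.∸ r) * B (suc r))
      ≈ sumTo (suc p) (λ r → binom (ι′ (suc p)) r * A (suc p ℕ.∸ r) * B r)
  binomial-step p A B = begin
    sumTo p (λ r → f r + g r)                                 ≈⟨ sumTo-+ p f g ⟩
    sumTo p f + sumTo p g                                     ≈⟨ +-congʳ f-extended ⟩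
    sumTo (suc p) f′ + sumTo p g                              ≈⟨ +-congʳ (sumTo-suc p f′) ⟩
    f′ 0 + sumTo p (λ r → f′ (suc r)) + sumTo p g             ≈⟨ +-assoc _ _ _ ⟩
    f′ 0 + (sumTo p (λ r → f′ (suc r)) + sumTo p g)           ≈⟨ +-congˡ (sumTo-+ p _ g) ⟨
    -- f′ 0 and T 0 agree definitionally: binom w 0 reduces to 1# * 1# ⁻¹ for every w.
    f′ 0 + sumTo p (λ r → f′ (suc r) + g r)                   ≈⟨ +-congˡ (sumTo-cong p pascal-term) ⟩
    T 0 + sumTo p (λ r → T (suc r))                           ≈⟨ sumTo-suc p T ⟨
    sumTo (suc p) T                                           ∎
    where
    C = binom (ι′ p)
    f g f′ T : ℕ → Carrier
    f  r = C r * A (suc (p ℕ.∸ r)) * B r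
    g  r = C r * A (p ℕ.∸ r) * B (suc r)
    f′ r = C r * A (suc p ℕ.∸ r) * B r
    T  r = binom (ι′ (suc p)) r * A (suc p ℕ.∸ r) * B r

    f′-top-vanishes : f′ (suc p) ≈ 0#
    f′-top-vanishes = trans (*-congʳ (*-congʳ (binom-ι-vanishes (ℕ.n<1+n p))))
                            (trans (*-congʳ (zeroˡ _)) (zeroˡ _))

    f-extended : sumTo p f ≈ sumTo (suc p) f′
    f-extended = begin
      sumTo p f          ≈⟨ sumTo-cong≤ p (λ r r≤p →
                              reflexive (≡.cong (λ i → C r * A i * B r) (≡.sym (ℕ.+-∸-assoc 1 r≤p)))) ⟩
      sumTo p f′         ≈⟨ +-identityʳ _ ⟨
      sumTo p f′ + 0#    ≈⟨ +-congˡ f′-top-vanishes ⟨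
      sumTo (suc p) f′   ∎

    collect : ∀ c d A B → c * A * B + d * A * B ≈ (d + c) * A * B
    collect = solve 4 (λ c d A B → c :* A :* B :+ d :* A :* B := (d :+ c) :* A :* B) refl

    pascal-term : ∀ r → f′ (suc r) + g r ≈ T (suc r)
    pascal-term r = trans (collect _ _ _ _)
      (*-congʳ (*-congʳ (trans (sym (pascal (ι′ p) r)) (binom-cong (suc r) (+-comm _ _)))))

  dff-binomial : ∀ p a b μ →
    dff (a + b) p μ ≈ sumTo p (λ r → binom (ι′ p) r * dff a (p ℕ.∸ r) μ * dff b r μ)
  dff-binomial zero    a b μ = sym (trans (*-identityʳ _) (trans (*-identityʳ _) (binom-zero 0#)))
  dff-binomial (suc p) a b μ = begin
    dff (a + b) p μ * X                                                        ≈⟨ *-congʳ (dff-binomial p a b μ) ⟩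
    sumTo p (λ r → binom (ι′ p) r * A (p ℕ.∸ r) * B r) * X                     ≈⟨ *-distribʳ-sumTo p X _ ⟩
    sumTo p (λ r → binom (ι′ p) r * A (p ℕ.∸ r) * B r * X)                     ≈⟨ sumTo-cong≤ p split ⟩
    sumTo p (λ r → binom (ι′ p) r * A (suc (p ℕ.∸ r)) * B r
                 + binom (ι′ p) r * A (p ℕ.∸ r) * B (suc r))                   ≈⟨ binomial-step p A B ⟩
    sumTo (suc p) (λ r → binom (ι′ (suc p)) r * A (suc p ℕ.∸ r) * B r)         ∎
    where
    X = a + b - ι′ p * μ
    A B : ℕ → Carrier
    A i = dff a i μ
    B i = dff b i μ

    distribute : ∀ c A B a b I R μ →
      c * A * B * (a + b - (I + R) * μ) ≈ c * (A * (a - I * μ)) * B + c * A * (B * (b - R * μ))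
    distribute = solve 8 (λ c A B a b I R μ →
      c :* A :* B :* (a :+ b :- (I :+ R) :* μ) := c :* (A :* (a :- I :* μ)) :* B :+ c :* A :* (B :* (b :- R :* μ))) refl

    split : ∀ r → r ℕ.≤ p → binom (ι′ p) r * A (p ℕ.∸ r) * B r * X
                          ≈ binom (ι′ p) r * A (suc (p ℕ.∸ r)) * B r + binom (ι′ p) r * A (p ℕ.∸ r) * B (suc r)
    split r r≤p = trans (*-congˡ (+-congˡ (-‿cong (*-congʳ (ι-∸ r≤p))))) (distribute _ _ _ _ _ _ _ _)

  pow-*-dff : ∀ {y} → ¬ (y ≈ 0#) → ∀ μ a r → pow y r * dff a r (μ / y) ≈ dff (y * a) r μ
  pow-*-dff y≉0 μ a zero    = *-identityˡ _
  pow-*-dff {y} y≉0 μ a (suc r) = begin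
    pow y r * y * (dff a r (μ / y) * (a - ι′ r * (μ * y ⁻¹)))          ≈⟨ regroup _ _ _ _ _ _ _ ⟩
    pow y r * dff a r (μ / y) * (y * a - ι′ r * μ * (y * y ⁻¹))        ≈⟨ *-cong (pow-*-dff y≉0 μ a r) (+-congˡ (-‿cong y-cancels)) ⟩
    dff (y * a) r μ * (y * a - ι′ r * μ)                              ∎
    where
    regroup : ∀ P y D a I μ Y → P * y * (D * (a - I * (μ * Y))) ≈ P * D * (y * a - I * μ * (y * Y))
    regroup = solve 7 (λ P y D a I μ Y →
      P :* y :* (D :* (a :- I :* (μ :* Y))) := P :* D :* (y :* a :- I :* μ :* (y :* Y))) refl
    y-cancels : ι′ r * μ * (y * y ⁻¹) ≈ ι′ r * μ
    y-cancels = trans (*-congˡ (⁻¹-inverse y y≉0)) (*-identityʳ _)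

  alternatingCoefficient : Carrier → ℕ → ℕ → Carrier
  alternatingCoefficient x n j = sgn j * binomℤ (ι′ n - x) ((+ n) ℤ.- (+ j)) * binom x j * fact j

  binom-reflect-product : ∀ x {w} N j → x + w + 1# ≈ ι′ N →
    sgn j * binomℤ w ((+ N) ℤ.- (+ j)) * binom x j * fact j ≈ sgn N * binom x N * ff (ι′ N) j
  binom-reflect-product x {w} N j x+w+1≈N with ℕ.≤-<-connex j N
  ... | inj₁ j≤N = begin
    sgn j * binomℤ w ((+ N) ℤ.- (+ j)) * binom x j * fact j
      ≡⟨ ≡.cong (λ d → sgn j * binomℤ w d * binom x j * fact j) (≡.trans (ℤ.m-n≡m⊖n N j) (ℤ.⊖-≥ j≤N)) ⟩
    sgn j * binom w m * binom x j * fact j              ≈⟨ *-assoc _ _ _ ⟩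
    sgn j * binom w m * (binom x j * fact j)            ≈⟨ *-cong (*-congˡ (binom-reflect m w+x-j+1≈m)) (binom-*-fact x j) ⟩
    sgn j * (sgn m * binom (x - ι′ j) m) * ff x j       ≈⟨ regroup _ _ _ _ ⟩
    sgn j * sgn m * (ff x j * binom (x - ι′ j) m)       ≈⟨ *-cong (pow-+ (- 1#) j m) (sym (trinomial-revision x j m)) ⟨
    sgn (j ℕ.+ m) * (binom x (j ℕ.+ m) * ff (ι′ (j ℕ.+ m)) j)
      ≡⟨ ≡.cong (λ N → sgn N * (binom x N * ff (ι′ N) j)) (ℕ.m+[n∸m]≡n j≤N) ⟩
    sgn N * (binom x N * ff (ι′ N) j)                   ≈⟨ *-assoc _ _ _ ⟨
    sgn N * binom x N * ff (ι′ N) j                     ∎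
    where
    m = N ℕ.∸ j
    regroup : ∀ s t B F → s * (t * B) * F ≈ s * t * (F * B)
    regroup = solve 4 (λ s t B F → s :* (t :* B) :* F := s :* t :* (F :* B)) refl
    w+x-j+1≈m : w + (x - ι′ j) + 1# ≈ ι′ m
    w+x-j+1≈m = begin
      w + (x - ι′ j) + 1#       ≈⟨ solve 3 (λ w x J → w :+ (x :- J) :+ con (+ 1) := x :+ w :+ con (+ 1) :- J) refl w x (ι′ j) ⟩
      x + w + 1# - ι′ j         ≈⟨ +-congʳ (trans x+w+1≈N (ι-∸ j≤N)) ⟩
      ι′ m + ι′ j - ι′ j        ≈⟨ solve 2 (λ M J → M :+ J :- J := M) refl (ι′ m) (ι′ j) ⟩
      ι′ m                      ∎
  ... | inj₂ N<j = begin
    sgn j * binomℤ w ((+ N) ℤ.- (+ j)) * binom x j * fact j   ≈⟨ *-congʳ (*-congʳ (*-congˡ (binomℤ-negative w N<j))) ⟩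
    sgn j * 0# * binom x j * fact j                          ≈⟨ *-congʳ (trans (*-congʳ (zeroʳ _)) (zeroˡ _)) ⟩
    0# * fact j                                              ≈⟨ zeroˡ _ ⟩
    0#                                                       ≈⟨ zeroʳ _ ⟨
    sgn N * binom x N * 0#                                   ≈⟨ *-congˡ (ff-ι-vanishes N<j) ⟨
    sgn N * binom x N * ff (ι′ N) j                          ∎

  alternating-ff-sum : ∀ x n j →
    sumTo n (λ k → sgn k * binom x k * ff (ι′ k) j) ≈ alternatingCoefficient x n j
  alternating-ff-sum x zero zero =
    *-congʳ (*-congʳ (sym (trans (*-congˡ (binom-zero (0# - x))) (*-identityˡ 1#))))
  alternating-ff-sum x zero (suc j) = begin
    1# * binom x 0 * ff 0# (suc j)         ≈⟨ *-congˡ (ff-ι-vanishes {0} {suc j} (ℕ.s≤s ℕ.z≤n)) ⟩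
    1# * binom x 0 * 0#                    ≈⟨ zeroʳ _ ⟩
    0#                                     ≈⟨ zeroˡ _ ⟨
    0# * fact (suc j)                      ≈⟨ *-congʳ (trans (*-congʳ (zeroʳ _)) (zeroˡ _)) ⟨
    sgn (suc j) * 0# * binom x (suc j) * fact (suc j) ∎
  alternating-ff-sum x (suc n) j = begin
    sumTo n (λ k → sgn k * binom x k * ff (ι′ k) j) + sgn (suc n) * binom x (suc n) * ff (ι′ (suc n)) j
      ≈⟨ +-cong (alternating-ff-sum x n j) (sym (binom-reflect-product x (suc n) j x+w+1≈n+1)) ⟩
    term d + sgn j * binomℤ w ((+ suc n) ℤ.- (+ j)) * binom x j * fact j
      ≡⟨ ≡.cong (λ e → term d + sgn j * binomℤ w e * binom x j * fact j) (index-suc n j) ⟩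
    term d + sgn j * binomℤ w (ℤ.suc d) * binom x j * fact j
      ≈⟨ collect _ _ _ _ _ ⟩
    sgn j * (binomℤ w d + binomℤ w (ℤ.suc d)) * binom x j * fact j
      ≈⟨ *-congʳ (*-congʳ (*-congˡ (trans (sym (pascalℤ w d)) (binomℤ-cong (ℤ.suc d) w+1≈n+1-x)))) ⟩
    sgn j * binomℤ (ι′ (suc n) - x) (ℤ.suc d) * binom x j * fact j
      ≡⟨ ≡.cong (λ e → sgn j * binomℤ (ι′ (suc n) - x) e * binom x j * fact j) (index-suc n j) ⟨
    alternatingCoefficient x (suc n) j ∎
    where
    w = ι′ n - x
    d = (+ n) ℤ.- (+ j)
    term : ℤ → Carrier
    term e = sgn j * binomℤ w e * binom x j * fact j
    index-suc : ∀ n j → (+ suc n) ℤ.- (+ j) ≡ ℤ.suc ((+ n) ℤ.- (+ j))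
    index-suc n j = ℤ.+-assoc (+ 1) (+ n) (ℤ.- (+ j))
    x+w+1≈n+1 : x + (ι′ n - x) + 1# ≈ 1# + ι′ n
    x+w+1≈n+1 = solve 2 (λ x N → x :+ (N :- x) :+ con (+ 1) := con (+ 1) :+ N) refl x (ι′ n)
    w+1≈n+1-x : ι′ n - x + 1# ≈ 1# + ι′ n - x
    w+1≈n+1-x = solve 2 (λ N x → N :- x :+ con (+ 1) := con (+ 1) :+ N :- x) refl (ι′ n) x
    collect : ∀ s a b c e → s * a * c * e + s * b * c * e ≈ s * (a + b) * c * e
    collect = solve 5 (λ s a b c e → s :* a :* c :* e :+ s :* b :* c :* e := s :* (a :+ b) :* c :* e) refl

  alternating-dff-sum : ∀ {μ} (S : ℕ → ℕ → Carrier) →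
    (∀ n x → dff x n μ ≈ sumTo n (λ k → S n k * ff x k)) →
    ∀ x n r → sumTo n (λ k → sgn k * binom x k * dff (ι′ k) r μ)
                ≈ sumTo r (λ j → alternatingCoefficient x n j * S r j)
  alternating-dff-sum {μ} S expand x n r = begin
    sumTo n (λ k → σ k * dff (ι′ k) r μ)                             ≈⟨ sumTo-cong n (λ k → *-congˡ (expand r (ι′ k))) ⟩
    sumTo n (λ k → σ k * sumTo r (λ j → S r j * ff (ι′ k) j))        ≈⟨ sumTo-cong n (λ k → *-distribˡ-sumTo r (σ k) _) ⟩
    sumTo n (λ k → sumTo r (λ j → σ k * (S r j * ff (ι′ k) j)))      ≈⟨ sumTo-comm n r _ ⟩
    sumTo r (λ j → sumTo n (λ k → σ k * (S r j * ff (ι′ k) j)))      ≈⟨ sumTo-cong r factor-out ⟩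
    sumTo r (λ j → sumTo n (λ k → σ k * ff (ι′ k) j) * S r j)        ≈⟨ sumTo-cong r (λ j → *-congʳ (alternating-ff-sum x n j)) ⟩
    sumTo r (λ j → alternatingCoefficient x n j * S r j)             ∎
    where
    σ : ℕ → Carrier
    σ k = sgn k * binom x k
    factor-out : ∀ j → sumTo n (λ k → σ k * (S r j * ff (ι′ k) j)) ≈ sumTo n (λ k → σ k * ff (ι′ k) j) * S r j
    factor-out j = sym (trans (*-distribʳ-sumTo n (S r j) _) (sumTo-cong n (λ k → xy∙z≈x∙zy _ _ _)))

corollary2p12 :
  ∀ {c ℓ} (F : CharZeroField c ℓ) →
    let open CharZeroField F
        open FieldOps F
    in (lam y : Carrier) → ¬ (lam ≈ 0#) → ¬ (y ≈ 0#) →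
       (S : ℕ → ℕ → Carrier) →
       (∀ n x → dff x n (lam / y) ≈ sumTo n (λ k → S n k * ff x k)) →
       ∀ (x z : Carrier) (n p : ℕ) →
       sumTo n (λ k → sgn k * binom x k * dff (z + y * ι′ k) p lam)
         ≈ sumTo p (λ r → binom (ι′ p) r * dff z (p Data.Nat.∸ r) lam * pow y r
             * sumTo r (λ j → sgn j * binomℤ (ι′ n - x) ((+ n) -ℤ (+ j))
                                * binom x j * fact j * S r j))
corollary2p12 F lam y _ y≉0 S S-expands x z n p = begin
  sumTo n (λ k → σ k * dff (z + y * ι′ k) p lam)
    ≈⟨ sumTo-cong n (λ k → *-congˡ (dff-binomial p z (y * ι′ k) lam)) ⟩
  sumTo n (λ k → σ k * sumTo p (λ r → γ r * dff (y * ι′ k) r lam))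
    ≈⟨ sumTo-cong n (λ k → *-distribˡ-sumTo p (σ k) _) ⟩
  sumTo n (λ k → sumTo p (λ r → σ k * (γ r * dff (y * ι′ k) r lam)))
    ≈⟨ sumTo-comm n p _ ⟩
  sumTo p (λ r → sumTo n (λ k → σ k * (γ r * dff (y * ι′ k) r lam)))
    ≈⟨ sumTo-cong p (λ r → sumTo-cong n (λ k → rescale r k)) ⟩
  sumTo p (λ r → sumTo n (λ k → γ r * pow y r * (σ k * dff (ι′ k) r (lam / y))))
    ≈⟨ sumTo-cong p (λ r → sym (*-distribˡ-sumTo n _ _)) ⟩
  sumTo p (λ r → γ r * pow y r * sumTo n (λ k → σ k * dff (ι′ k) r (lam / y)))
    ≈⟨ sumTo-cong p (λ r → *-congˡ (alternating-dff-sum S S-expands x n r)) ⟩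
  sumTo p (λ r → γ r * pow y r * sumTo r (λ j → alternatingCoefficient x n j * S r j))
    ∎
  where
  open CharZeroField F
  open FieldOps F
  open DegenerateFactorialIdentities F
  open IntegerCoefficientSolver commutativeRing
  open import Relation.Binary.Reasoning.Setoid setoid

  σ γ : ℕ → Carrier
  σ k = sgn k * binom x k
  γ r = binom (ι′ p) r * dff z (p ℕ.∸ r) lam

  regroup : ∀ s c P E → s * (c * (P * E)) ≈ c * P * (s * E)
  regroup = solve 4 (λ s c P E → s :* (c :* (P :* E)) := c :* P :* (s :* E)) refl

  rescale : ∀ r k → σ k * (γ r * dff (y * ι′ k) r lam) ≈ γ r * pow y r * (σ k * dff (ι′ k) r (lam / y))
  rescale r k = trans (*-congˡ (*-congˡ (sym (pow-*-dff y≉0 lam (ι′ k) r)))) (regroup _ _ _ _)
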